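{- Let $\Sigma$ be a signed alphabet. Consider the monoid presentation whose generators are the symbols $c_u$, one for each nonempty super column $u$ over $\Sigma$, and whose relations are the following. - For every super column $u=x_p\ldots x_1$ with $p\ge2$ and $x_i\in\Sigma$: the relation $\mu_u:\ c_{x_p}\cdots c_{x_1}\Rightarrow c_u$. - For all $x\le y\le z$ in $\Sigma$ with $x=y$ only if $\|y\|=0$ and $y=z$ only if $\|y\|=1$: the relation $c_zc_xc_y\Rightarrow c_xc_zc_y$. - For all $x\le y\le z$ in $\Sigma$ with $x=y$ only if $\|y\|=1$ and $y=z$ only if $\|y\|=0$: the relation $c_yc_zc_x\Rightarrow c_yc_xc_z$. Then the monoid presented by these generators and relations is isomorphic to the super plactic monoid $\mathbf{P}(\Sigma)$.
   Context: A signed alphabet is a finite or countable totally ordered set $\Sigma$ with a map $\|\cdot\|:\Sigma\to\mathbb{Z}_2$. A super column is a word $x_1\ldots x_k$ over $\Sigma$ with $x_{i+1}\le x_i$ for all $i$, where $x_i=x_{i+1}$ only if $\|x_i\|=1$. The super plactic monoid $\mathbf{P}(\Sigma)$ is the quotient of the free monoid $\Sigma^*$ by the congruence generated by the following relations: - $zxy=xzy$ for $x\le y\le z$ in $\Sigma$, with $x=y$ only if $\|y\|=0$ and $y=z$ only if $\|y\|=1$; - $yzx=yxz$ for $x\le y\le z$ in $\Sigma$, with $x=y$ only if $\|y\|=1$ and $y=z$ only if $\|y\|=0$. -}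

module Defs where

open import Data.Nat using (ℕ)
import Data.Nat
open import Data.Fin using (Fin; zero; suc)
open import Data.List using (List; []; _∷_; _++_; map; length)
open import Data.List.Relation.Unary.Linked using (Linked; [-])
open import Data.Product using (_×_; Σ)
open import Relation.Binary.PropositionalEquality using (_≡_)
open import Relation.Binary.Structures using (IsTotalOrder)
open import Relation.Binary.Construct.Closure.Equivalence using (EqClosure)
open import Relation.Nullary using (¬_)
open import Function.Definitions using (Injective)

ℤ₂ : Set
ℤ₂ = Fin 2

-- A signed alphabet: a totally ordered set, finite or countable
-- (i.e. admitting an injection into ℕ), with a sign map to ℤ₂.
record SignedAlphabet : Set₁ where
  field
    Carrier      : Set
    _≤_          : Carrier → Carrier → Set
    isTotalOrder : IsTotalOrder _≡_ _≤_
    ‖_‖          : Carrier → ℤ₂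
    encode       : Carrier → ℕ
    encode-inj   : Injective _≡_ _≡_ encode

module _ (Σ' : SignedAlphabet) where
  open SignedAlphabet Σ'

  ColStep : Carrier → Carrier → Set
  ColStep a b = (b ≤ a) × (b ≡ a → ‖ a ‖ ≡ suc zero)

  IsSuperColumn : List Carrier → Set
  IsSuperColumn = Linked ColStep

  -- Generators c_u, u a nonempty super column (proofs irrelevant, so
  -- c_u depends only on the word u).
  record Gen : Set where
    constructor c[_]
    field
      word        : List Carrier
      .nonempty   : ¬ (word ≡ [])
      .isColumn   : IsSuperColumn word

  c₁ : Carrier → Gen
  c₁ x = record { word = x ∷ [] ; nonempty = λ () ; isColumn = [-] }

  data PlacticRel : List Carrier → List Carrier → Set where
    knuth₁ : ∀ x y z → x ≤ y → y ≤ z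
           → (x ≡ y → ‖ y ‖ ≡ zero) → (y ≡ z → ‖ y ‖ ≡ suc zero)
           → PlacticRel (z ∷ x ∷ y ∷ []) (x ∷ z ∷ y ∷ [])
    knuth₂ : ∀ x y z → x ≤ y → y ≤ z
           → (x ≡ y → ‖ y ‖ ≡ suc zero) → (y ≡ z → ‖ y ‖ ≡ zero)
           → PlacticRel (y ∷ z ∷ x ∷ []) (y ∷ x ∷ z ∷ [])

  data ColumnRel : List Gen → List Gen → Set where
    μ      : (u : List Carrier) → (2 Data.Nat.≤ length u) → (col : IsSuperColumn u)
           → (ne : ¬ (u ≡ []))
           → ColumnRel (map c₁ u) (record { word = u ; nonempty = ne ; isColumn = col } ∷ [])
    knuth₁ : ∀ x y z → x ≤ y → y ≤ z
           → (x ≡ y → ‖ y ‖ ≡ zero) → (y ≡ z → ‖ y ‖ ≡ suc zero)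
           → ColumnRel (c₁ z ∷ c₁ x ∷ c₁ y ∷ []) (c₁ x ∷ c₁ z ∷ c₁ y ∷ [])
    knuth₂ : ∀ x y z → x ≤ y → y ≤ z
           → (x ≡ y → ‖ y ‖ ≡ suc zero) → (y ≡ z → ‖ y ‖ ≡ zero)
           → ColumnRel (c₁ y ∷ c₁ z ∷ c₁ x ∷ []) (c₁ y ∷ c₁ x ∷ c₁ z ∷ [])

data Step {X : Set} (R : List X → List X → Set) : List X → List X → Set where
  step : ∀ (p q : List X) {u v} → R u v → Step R (p ++ u ++ q) (p ++ v ++ q)

Cong : {X : Set} → (List X → List X → Set) → List X → List X → Set
Cong R = EqClosure (Step R)

-- Isomorphism of the presented monoids X*/Cong R and Y*/Cong S,
-- given on representatives: two monoid homomorphisms between the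
-- quotients that are mutually inverse.
record PresIso {X Y : Set} (R : List X → List X → Set) (S : List Y → List Y → Set) : Set where
  field
    to       : List X → List Y
    from     : List Y → List X
    to-cong  : ∀ {u v} → Cong R u v → Cong S (to u) (to v)
    to-ε     : Cong S (to []) []
    to-·     : ∀ u v → Cong S (to (u ++ v)) (to u ++ to v)
    from-cong : ∀ {u v} → Cong S u v → Cong R (from u) (from v)
    from-ε   : Cong R (from []) []
    from-·   : ∀ u v → Cong R (from (u ++ v)) (from u ++ from v)
    from-to  : ∀ u → Cong R (from (to u)) u
    to-from  : ∀ w → Cong S (to (from w)) w

{-# OPTIONS --safe #-}
module Submission where

-- Flattening each generator c_u into the word u, and sending each letter
-- x to c_x, are mutually inverse: flattening maps each μ_u to a trivial
-- equation and each Knuth relation to itself, while the letters c_x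
-- generate the column monoid because μ_u rewrites the letters of any
-- column u into c_u.

open import Defs
open import Data.Nat using (s≤s; z≤n)
import Data.Nat.Properties as ℕ
import Data.Fin.Properties as Fin
open import Data.Fin using (zero; suc)
open import Data.List using (List; []; _∷_; [_]; _++_; map; concatMap)
open import Data.List.Properties using (++-assoc; ++-identityʳ; map-++; concatMap-++; concatMap-map; concatMap-pure)
open import Data.List.Relation.Unary.Linked using (linked?)
open import Data.Empty using (⊥-elim-irr)
open import Function.Bundles using (mk↣)
open import Relation.Binary.Definitions using (Decidable)
open import Relation.Binary.Consequences using (total∧dec⇒dec)
open import Relation.Binary.Structures using (IsTotalOrder; IsEquivalence)
open import Relation.Binary.PropositionalEquality using (_≡_; refl; sym; trans; cong; subst; subst₂; module ≡-Reasoning)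
open import Relation.Binary.Construct.Closure.Equivalence as EqClosure using (gfold; gmap; transitive; return)
open import Relation.Nullary.Decidable using (recompute; via-injection; _×-dec_; _→-dec_)

module _ {X : Set} {R : List X → List X → Set} where

  Cong-reflexive : ∀ {u v} → u ≡ v → Cong R u v
  Cong-reflexive = IsEquivalence.reflexive (EqClosure.isEquivalence (Step R))

  Cong-rule : ∀ {u v} → R u v → Cong R u v
  Cong-rule {u} {v} r = return (subst₂ (Step R) (++-identityʳ u) (++-identityʳ v) (step [] [] r))

  Step-context : ∀ p q {u v} → Step R u v → Step R (p ++ u ++ q) (p ++ v ++ q)
  Step-context p q (step p′ q′ {u} {v} r) =
    subst₂ (Step R) (reassoc u) (reassoc v) (step (p ++ p′) (q′ ++ q) r)
    where
    open ≡-Reasoning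
    reassoc : ∀ w → (p ++ p′) ++ w ++ q′ ++ q ≡ p ++ (p′ ++ w ++ q′) ++ q
    reassoc w = begin
      (p ++ p′) ++ w ++ q′ ++ q   ≡⟨ ++-assoc p p′ _ ⟩
      p ++ p′ ++ w ++ q′ ++ q     ≡⟨ cong (λ t → p ++ p′ ++ t) (++-assoc w q′ q) ⟨
      p ++ p′ ++ (w ++ q′) ++ q   ≡⟨ cong (p ++_) (++-assoc p′ (w ++ q′) q) ⟨
      p ++ (p′ ++ w ++ q′) ++ q   ∎

  Cong-context : ∀ p q {u v} → Cong R u v → Cong R (p ++ u ++ q) (p ++ v ++ q)
  Cong-context p q = gmap (λ w → p ++ w ++ q) (Step-context p q)

  Cong-++ : ∀ {u u′ v v′} → Cong R u u′ → Cong R v v′ → Cong R (u ++ v) (u′ ++ v′)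
  Cong-++ {u′ = u′} {v} {v′} u≈u′ v≈v′ = transitive _ (Cong-context [] v u≈u′)
    (subst₂ (λ s t → Cong R (u′ ++ s) (u′ ++ t)) (++-identityʳ v) (++-identityʳ v′)
      (Cong-context u′ [] v≈v′))

Cong-map : {X Y : Set} {R : List X → List X → Set} {S : List Y → List Y → Set}
           (f : List X → List Y) → (∀ u v → f (u ++ v) ≡ f u ++ f v)
           → (∀ {u v} → R u v → Cong S (f u) (f v))
           → ∀ {u v} → Cong R u v → Cong S (f u) (f v)
Cong-map {R = R} {S} f f-++ f-R = gfold (EqClosure.isEquivalence (Step S)) f f-Step
  where
  f-context : ∀ p u q → f (p ++ u ++ q) ≡ f p ++ f u ++ f q
  f-context p u q = trans (f-++ p (u ++ q)) (cong (f p ++_) (f-++ u q))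
  f-Step : ∀ {u v} → Step R u v → Cong S (f u) (f v)
  f-Step (step p q {u} {v} r) =
    subst₂ (Cong S) (sym (f-context p u q)) (sym (f-context p v q)) (Cong-context (f p) (f q) (f-R r))

module _ (Σ' : SignedAlphabet) where
  open SignedAlphabet Σ'
  open IsTotalOrder isTotalOrder using (total; antisym; reflexive)

  _≟_ : Decidable {A = Carrier} _≡_
  _≟_ = via-injection (mk↣ encode-inj) ℕ._≟_

  _≤?_ : Decidable _≤_
  _≤?_ = total∧dec⇒dec reflexive antisym total _≟_

  ColStep? : Decidable (ColStep Σ')
  ColStep? a b = (b ≤? a) ×-dec ((b ≟ a) →-dec (‖ a ‖ Fin.≟ suc zero))

  letters : List Carrier → List (Gen Σ')
  letters = map (c₁ Σ')

  flatten : List (Gen Σ') → List Carrier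
  flatten = concatMap Gen.word

  flatten-letters : ∀ w → flatten (letters w) ≡ w
  flatten-letters w = trans (concatMap-map Gen.word (c₁ Σ') w) (concatMap-pure w)

  flatten-ColumnRel : ∀ {u v} → ColumnRel Σ' u v → Cong (PlacticRel Σ') (flatten u) (flatten v)
  flatten-ColumnRel (μ u _ _ _)            = Cong-reflexive (trans (flatten-letters u) (sym (++-identityʳ u)))
  flatten-ColumnRel (knuth₁ x y z a b c d) = Cong-rule (knuth₁ x y z a b c d)
  flatten-ColumnRel (knuth₂ x y z a b c d) = Cong-rule (knuth₂ x y z a b c d)

  letters-PlacticRel : ∀ {u v} → PlacticRel Σ' u v → Cong (ColumnRel Σ') (letters u) (letters v)
  letters-PlacticRel (knuth₁ x y z a b c d) = Cong-rule (knuth₁ x y z a b c d)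
  letters-PlacticRel (knuth₂ x y z a b c d) = Cong-rule (knuth₂ x y z a b c d)

  -- The column proof stored in a generator is irrelevant, but μ needs it
  -- relevantly; it is decidable, hence recomputable.
  letters-word : (g : Gen Σ') → Cong (ColumnRel Σ') (letters (Gen.word g)) [ g ]
  letters-word (c[_] [] ne _)          = ⊥-elim-irr (ne refl)
  letters-word (c[_] (x ∷ []) _ _)     = Cong-reflexive refl
  letters-word (c[_] (x ∷ y ∷ w) _ col) =
    Cong-rule (μ (x ∷ y ∷ w) (s≤s (s≤s z≤n)) (recompute (linked? ColStep? (x ∷ y ∷ w)) col) λ ())

  letters-flatten : ∀ u → Cong (ColumnRel Σ') (letters (flatten u)) u
  letters-flatten []      = Cong-reflexive refl
  letters-flatten (g ∷ u) = subst (λ t → Cong (ColumnRel Σ') t (g ∷ u)) (sym (map-++ (c₁ Σ') (Gen.word g) (flatten u)))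
                              (Cong-++ (letters-word g) (letters-flatten u))

proposition2p3 : (Σ' : SignedAlphabet) → PresIso (ColumnRel Σ') (PlacticRel Σ')
proposition2p3 Σ' = record
  { to        = flatten Σ'
  ; from      = letters Σ'
  ; to-cong   = Cong-map (flatten Σ') (concatMap-++ Gen.word) (flatten-ColumnRel Σ')
  ; to-ε      = Cong-reflexive refl
  ; to-·      = λ u v → Cong-reflexive (concatMap-++ Gen.word u v)
  ; from-cong = Cong-map (letters Σ') (map-++ (c₁ Σ')) (letters-PlacticRel Σ')
  ; from-ε    = Cong-reflexive refl
  ; from-·    = λ u v → Cong-reflexive (map-++ (c₁ Σ') u v)
  ; from-to   = letters-flatten Σ'
  ; to-from   = λ w → Cong-reflexive (flatten-letters Σ' w)
  }
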